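{- For $m\ge 2$ and $1\leq i\leq m-1$ let $$c_i(m)=\frac{d_i(m)^2}{d_{i-1}(m)d_{i+1}(m)},\qquad u_i(m)=\left(1+\frac1i\right)\left(1+\frac{1}{m-i}\right).$$ Then for every fixed integer $i\geq 1$, $$\lim_{m\to\infty}\frac{c_i(m)}{u_i(m)}=1.$$
   Context: For integers $m\geq 0$, the Boros-Moll polynomial is $P_m(a)=2^{ -2m}\sum_{k}2^k\binom{2m-2k}{m-k}\binom{m+k}{k}(a+1)^k=\sum_{i=0}^m d_i(m)a^i$, so that $d_i(m)=2^{ -2m}\sum_{k=0}^m 2^k\binom{2m-2k}{m-k}\binom{m+k}{m}\binom{k}{i}$ for $0\le i\le m$. These coefficients are positive. -}

module Defs where

open import Data.Nat as ℕ using (ℕ; zero; suc; _∸_; _^_)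
open import Data.Nat.Combinatorics using (_C_)
open import Data.List using (List; map; upTo)
open import Data.Nat.ListAction using (sum)
open import Data.Integer using (+_)
open import Data.Rational
  using (ℚ; 0ℚ; 1ℚ; _+_; _*_; _÷_; _/_; ≢-nonZero)
open import Data.Rational.Properties using (_≟_)
open import Relation.Nullary using (yes; no)

-- Division on ℚ made total: x ÷ 0 := 0.  It is only ever applied to
-- denominators that are positive in the relevant range (d_i(m) > 0 for
-- 0 ≤ i ≤ m, and i ≥ 1, m - i ≥ 1 in u_i(m)).
_/ℚ_ : ℚ → ℚ → ℚ
p /ℚ q with q ≟ 0ℚ
... | yes _  = 0ℚ
... | no q≢0 = _÷_ p q {{≢-nonZero q≢0}}

ℕ→ℚ : ℕ → ℚ
ℕ→ℚ n = (+ n) / 1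

bmSum : ℕ → ℕ → ℕ
bmSum i m = sum (map term (upTo (suc m)))
  where
  term : ℕ → ℕ
  term k = (2 ^ k) ℕ.* ((2 ℕ.* m ∸ 2 ℕ.* k) C (m ∸ k))
             ℕ.* ((m ℕ.+ k) C m) ℕ.* (k C i)

d : ℕ → ℕ → ℚ
d i m = ℕ→ℚ (bmSum i m) /ℚ ℕ→ℚ (2 ^ (2 ℕ.* m))

c : ℕ → ℕ → ℚ
c i m = (d i m * d i m) /ℚ (d (i ∸ 1) m * d (suc i) m)

u : ℕ → ℕ → ℚ
u i m = (1ℚ + (1ℚ /ℚ ℕ→ℚ i)) * (1ℚ + (1ℚ /ℚ ℕ→ℚ (m ∸ i)))

module Submission where

-- Write w_m(k) = 2^k C(2m-2k, m-k) C(m+k, m), so that 4^m d_j(m) = S_j(m) =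
-- Σ_{k ≤ m} w_m(k) C(k, j).  With i = s+1 and m = i + t one finds
--   c_i(m)/u_i(m) = S_i² i t / (S_{i-1} S_{i+1} (i+1)(t+1)),
-- and the proof pinches this ratio between N/(N+1) and (N+1)/N for t large.
--   • Exact bounds: Σ w_k C(k,s) k = (s+1) S_{s+1} + s S_s, and k ≤ m,
--     give i S_i ≤ (t+1) S_{i-1} and (i+1) S_{i+1} ≤ t S_i.
--   • Concentration: the weights satisfy a two-term recurrence; telescoping
--     it yields 2(m+1) M₁ = (m+m²) M₀ + M₂ for the moments M_r = Σ w_k k^r.
--     With Cauchy–Schwarz this bounds the deficit D = m M₀ - M₁ by
--     D² ≤ m M₀², so the weights concentrate near k = m; Chebyshev's sum
--     inequality then turns this into the reverse bounds up to a factor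
--     1 + O(√m / t).

module Binomial where

  open import Data.Nat
  open import Data.Nat.Properties
  open import Data.Nat.Combinatorics using (_C_; nCk+nC[k+1]≡[n+1]C[k+1]; nC1≡n; nCk≡nC[n∸k])
  open import Data.Nat.Tactic.RingSolver using (solve-∀)
  open import Relation.Binary.PropositionalEquality

  pascal : ∀ n k → suc n C suc k ≡ n C k + n C suc k
  pascal n k = sym (nCk+nC[k+1]≡[n+1]C[k+1] n k)

  absorption : ∀ n k → suc k * (suc n C suc k) ≡ suc n * (n C k)
  absorption n zero = trans (+-identityʳ (suc n C 1)) (trans (nC1≡n (suc n)) (sym (*-identityʳ (suc n))))
  absorption zero (suc k) = *-zeroʳ (suc (suc k))
  absorption (suc n) (suc k) = begin
    suc (suc k) * (suc (suc n) C suc (suc k))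
      ≡⟨ cong (suc (suc k) *_) (pascal (suc n) (suc k)) ⟩
    suc (suc k) * (x + y)
      ≡⟨ split k x y ⟩
    suc k * x + (x + suc (suc k) * y)
      ≡⟨ cong₂ (λ p q → p + (x + q)) (absorption n k) (absorption n (suc k)) ⟩
    suc n * (n C k) + (x + suc n * (n C suc k))
      ≡⟨ cong (λ p → suc n * (n C k) + (p + suc n * (n C suc k))) (pascal n k) ⟩
    suc n * (n C k) + ((n C k + n C suc k) + suc n * (n C suc k))
      ≡⟨ merge (suc n) (n C k) (n C suc k) ⟩
    suc (suc n) * (n C k + n C suc k)
      ≡⟨ cong (suc (suc n) *_) (sym (pascal n k)) ⟩
    suc (suc n) * (suc n C suc k) ∎
    where
    open ≡-Reasoning
    x = suc n C suc k
    y = suc n C suc (suc k)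
    split : ∀ a x y → suc (suc a) * (x + y) ≡ suc a * x + (x + suc (suc a) * y)
    split = solve-∀
    merge : ∀ a x y → a * x + ((x + y) + a * y) ≡ suc a * (x + y)
    merge = solve-∀

  -- (s+1) C(n,s+1) + s C(n,s) = n C(n,s): the identity converting the
  -- moment Σ w_k k C(k,s) into binomial moments S_{s+1}, S_s.
  lower-index-step : ∀ n s → suc s * (n C suc s) + s * (n C s) ≡ n * (n C s)
  lower-index-step zero zero = refl
  lower-index-step zero (suc s) = cong₂ _+_ (*-zeroʳ (suc (suc s))) (*-zeroʳ (suc s))
  lower-index-step (suc n) zero = trans (+-identityʳ _) (absorption n zero)
  lower-index-step (suc n) (suc s) = begin
    suc (suc s) * (suc n C suc (suc s)) + suc s * (suc n C suc s)
      ≡⟨ cong₂ _+_ (absorption n (suc s)) (absorption n s) ⟩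
    suc n * (n C suc s) + suc n * (n C s)
      ≡⟨ sym (*-distribˡ-+ (suc n) (n C suc s) (n C s)) ⟩
    suc n * (n C suc s + n C s)
      ≡⟨ cong (suc n *_) (trans (+-comm (n C suc s) (n C s)) (sym (pascal n s))) ⟩
    suc n * (suc n C suc s) ∎
    where open ≡-Reasoning

  symmetry : ∀ a b → (a + b) C a ≡ (a + b) C b
  symmetry a b = trans (nCk≡nC[n∸k] (m≤m+n a b)) (cong ((a + b) C_) (m+n∸m≡n a b))

  upper-step : ∀ n k → n C k ≤ suc n C k
  upper-step n zero = ≤-refl
  upper-step n (suc j) = subst (n C suc j ≤_) (sym (pascal n j)) (m≤n+m (n C suc j) (n C j))

  upper-monotone : ∀ {a b} k → a ≤ b → a C k ≤ b C k
  upper-monotone {a} k a≤b = go (≤⇒≤′ a≤b)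
    where
    go : ∀ {b} → a ≤′ b → a C k ≤ b C k
    go ≤′-refl = ≤-refl
    go (≤′-step a≤′b) = ≤-trans (go a≤′b) (upper-step _ k)

  positive : ∀ {n k} → k ≤ n → 0 < n C k
  positive {n} {zero} _ = s≤s z≤n
  positive {suc n} {suc k} (s≤s k≤n) =
    subst (0 <_) (sym (pascal n k)) (≤-trans (positive k≤n) (m≤m+n (n C k) (n C suc k)))

module Sums where

  open import Data.Nat
  open import Data.Nat.Properties
  open import Data.Nat.Tactic.RingSolver using (solve-∀)
  open import Data.List using ([]; _∷_; map; upTo; applyUpTo; _++_)
  open import Data.List.Properties using (applyUpTo-∷ʳ; map-upTo)
  open import Data.Nat.ListAction using (sum)
  open import Data.Nat.ListAction.Properties using (sum-++)
  open import Data.Product using (_,_)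
  open import Relation.Binary.PropositionalEquality

  sumBelow : ℕ → (ℕ → ℕ) → ℕ
  sumBelow zero f = 0
  sumBelow (suc n) f = sumBelow n f + f n

  infix 6.5 sumBelow
  syntax sumBelow n (λ k → e) = ∑[ k < n ] e

  sum-upTo : ∀ (f : ℕ → ℕ) n → sum (map f (upTo n)) ≡ ∑[ k < n ] f k
  sum-upTo f n = trans (cong sum (map-upTo f n)) (applied n)
    where
    applied : ∀ n → sum (applyUpTo f n) ≡ ∑[ k < n ] f k
    applied zero = refl
    applied (suc n) = begin
      sum (applyUpTo f (suc n))              ≡⟨ cong sum (sym (applyUpTo-∷ʳ f n)) ⟩
      sum (applyUpTo f n ++ (f n ∷ []))      ≡⟨ sum-++ (applyUpTo f n) (f n ∷ []) ⟩
      sum (applyUpTo f n) + (f n + 0)        ≡⟨ cong₂ _+_ (applied n) (+-identityʳ (f n)) ⟩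
      (∑[ k < n ] f k) + f n                 ∎
      where open ≡-Reasoning

  ∑-cong : ∀ {f g : ℕ → ℕ} n → (∀ k → k < n → f k ≡ g k) → ∑[ k < n ] f k ≡ ∑[ k < n ] g k
  ∑-cong zero _ = refl
  ∑-cong (suc n) f≡g = cong₂ _+_ (∑-cong n (λ k k<n → f≡g k (m<n⇒m<1+n k<n))) (f≡g n ≤-refl)

  ∑-mono : ∀ {f g : ℕ → ℕ} n → (∀ k → k < n → f k ≤ g k) → ∑[ k < n ] f k ≤ ∑[ k < n ] g k
  ∑-mono zero _ = z≤n
  ∑-mono (suc n) f≤g = +-mono-≤ (∑-mono n (λ k k<n → f≤g k (m<n⇒m<1+n k<n))) (f≤g n ≤-refl)

  ∑-+ : ∀ (f g : ℕ → ℕ) n → ∑[ k < n ] (f k + g k) ≡ (∑[ k < n ] f k) + (∑[ k < n ] g k)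
  ∑-+ f g zero = refl
  ∑-+ f g (suc n) = trans (cong (_+ (f n + g n)) (∑-+ f g n)) (swap (sumBelow n f) (sumBelow n g) (f n) (g n))
    where
    swap : ∀ a b c d → a + b + (c + d) ≡ a + c + (b + d)
    swap = solve-∀

  ∑-*ˡ : ∀ c (f : ℕ → ℕ) n → ∑[ k < n ] (c * f k) ≡ c * (∑[ k < n ] f k)
  ∑-*ˡ c f zero = sym (*-zeroʳ c)
  ∑-*ˡ c f (suc n) = trans (cong (_+ c * f n) (∑-*ˡ c f n)) (sym (*-distribˡ-+ c _ (f n)))

  ∑-head : ∀ (f : ℕ → ℕ) n → ∑[ k < suc n ] f k ≡ f 0 + (∑[ k < n ] f (suc k))
  ∑-head f zero = +-comm 0 (f 0)
  ∑-head f (suc n) = trans (cong (_+ f (suc n)) (∑-head f n)) (+-assoc (f 0) _ (f (suc n)))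

  term≤∑ : ∀ (f : ℕ → ℕ) n → f n ≤ ∑[ k < suc n ] f k
  term≤∑ f n = m≤n+m (f n) (∑[ k < n ] f k)

  Monotone : (ℕ → ℕ) → Set
  Monotone f = ∀ {a b} → a ≤ b → f a ≤ f b

  rearrangement : ∀ {x y a b} → x ≤ a → y ≤ b → x * b + a * y ≤ x * y + a * b
  rearrangement {x} {y} x≤a y≤b with m≤n⇒∃[o]m+o≡n x≤a | m≤n⇒∃[o]m+o≡n y≤b
  ... | o , refl | r , refl = subst (x * (y + r) + (x + o) * y ≤_) (expand x y o r) (m≤m+n _ (o * r))
    where
    expand : ∀ x y o r → x * (y + r) + (x + o) * y + o * r ≡ x * y + (x + o) * (y + r)
    expand = solve-∀

  -- Induction on n; the new cross terms are controlled by the rearrangement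
  -- inequality applied to each pair (k, n) with k < n.
  chebyshev : ∀ (w f g : ℕ → ℕ) → Monotone f → Monotone g → ∀ n →
    (∑[ k < n ] w k * f k) * (∑[ k < n ] w k * g k) ≤ (∑[ k < n ] w k * (f k * g k)) * (∑[ k < n ] w k)
  chebyshev w f g f↑ g↑ zero = z≤n
  chebyshev w f g f↑ g↑ (suc n) =
    subst₂ _≤_ (sym (expandˡ F G (w n) (f n) (g n))) (sym (expandʳ H W (w n) (f n) (g n)))
      (+-mono-≤ (+-mono-≤ (chebyshev w f g f↑ g↑ n) (*-monoʳ-≤ (w n) cross)) ≤-refl)
    where
    F = ∑[ k < n ] w k * f k
    G = ∑[ k < n ] w k * g k
    H = ∑[ k < n ] w k * (f k * g k)
    W = ∑[ k < n ] w k
    cross : g n * F + f n * G ≤ H + f n * g n * W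
    cross = begin
      g n * F + f n * G
        ≡⟨ sym (cong₂ _+_ (∑-*ˡ (g n) (λ k → w k * f k) n) (∑-*ˡ (f n) (λ k → w k * g k) n)) ⟩
      (∑[ k < n ] g n * (w k * f k)) + (∑[ k < n ] f n * (w k * g k))
        ≡⟨ sym (∑-+ (λ k → g n * (w k * f k)) (λ k → f n * (w k * g k)) n) ⟩
      ∑[ k < n ] (g n * (w k * f k) + f n * (w k * g k))
        ≤⟨ ∑-mono n pairwise ⟩
      ∑[ k < n ] (w k * (f k * g k) + f n * g n * w k)
        ≡⟨ ∑-+ (λ k → w k * (f k * g k)) (λ k → f n * g n * w k) n ⟩
      H + (∑[ k < n ] f n * g n * w k)
        ≡⟨ cong (H +_) (∑-*ˡ (f n * g n) w n) ⟩
      H + f n * g n * W ∎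
      where
      open ≤-Reasoning
      regroupˡ : ∀ w x y a b → w * (x * b + a * y) ≡ b * (w * x) + a * (w * y)
      regroupˡ = solve-∀
      regroupʳ : ∀ w x y a b → w * (x * y + a * b) ≡ w * (x * y) + a * b * w
      regroupʳ = solve-∀
      pairwise : ∀ k → k < n → g n * (w k * f k) + f n * (w k * g k) ≤ w k * (f k * g k) + f n * g n * w k
      pairwise k k<n = subst₂ _≤_ (regroupˡ (w k) (f k) (g k) (f n) (g n)) (regroupʳ (w k) (f k) (g k) (f n) (g n))
        (*-monoʳ-≤ (w k) (rearrangement (f↑ (<⇒≤ k<n)) (g↑ (<⇒≤ k<n))))
    expandˡ : ∀ F G w f g → (F + w * f) * (G + w * g) ≡ F * G + w * (g * F + f * G) + w * w * (f * g)
    expandˡ = solve-∀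
    expandʳ : ∀ H W w f g → (H + w * (f * g)) * (W + w) ≡ H * W + w * (H + f * g * W) + w * w * (f * g)
    expandʳ = solve-∀

module Weights where

  open import Data.Nat
  open import Data.Nat.Properties
  open import Data.Nat.Combinatorics using (_C_)
  open import Data.Nat.Tactic.RingSolver using (solve-∀)
  open import Relation.Binary.PropositionalEquality
  open Binomial

  -- The weights w_m(k) = 2^k C(2m-2k, m-k) C(m+k, m); literally the
  -- summand of d_i(m) without its last factor C(k, i).
  w : ℕ → ℕ → ℕ
  w m k = (2 ^ k) * ((2 * m ∸ 2 * k) C (m ∸ k)) * ((m + k) C m)

  central : ∀ t → suc t * (suc (suc (t + t)) C suc t) ≡ 2 * suc (t + t) * ((t + t) C t)
  central t = begin
    suc t * (suc (suc (t + t)) C suc t)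
      ≡⟨ cong (suc t *_) (pascal (suc (t + t)) t) ⟩
    suc t * (suc (t + t) C t + suc (t + t) C suc t)
      ≡⟨ cong (λ x → suc t * (x + suc (t + t) C suc t)) middle ⟩
    suc t * (suc (t + t) C suc t + suc (t + t) C suc t)
      ≡⟨ double (suc t) (suc (t + t) C suc t) ⟩
    2 * (suc t * (suc (t + t) C suc t))
      ≡⟨ cong (2 *_) (absorption (t + t) t) ⟩
    2 * (suc (t + t) * ((t + t) C t))
      ≡⟨ sym (*-assoc 2 (suc (t + t)) ((t + t) C t)) ⟩
    2 * suc (t + t) * ((t + t) C t) ∎
    where
    open ≡-Reasoning
    middle : suc (t + t) C t ≡ suc (t + t) C suc t
    middle = subst (λ n → n C t ≡ n C suc t) (+-suc t t) (symmetry t (suc t))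
    double : ∀ a x → a * (x + x) ≡ 2 * (a * x)
    double = solve-∀

  upper-shift : ∀ m k → ((m + suc k) C m) * suc k ≡ ((m + k) C m) * suc (m + k)
  upper-shift m k = begin
    ((m + suc k) C m) * suc k     ≡⟨ cong (_* suc k) (symmetry m (suc k)) ⟩
    ((m + suc k) C suc k) * suc k ≡⟨ cong (λ n → (n C suc k) * suc k) (+-suc m k) ⟩
    (suc (m + k) C suc k) * suc k ≡⟨ *-comm _ (suc k) ⟩
    suc k * (suc (m + k) C suc k) ≡⟨ absorption (m + k) k ⟩
    suc (m + k) * ((m + k) C k) ≡⟨ cong (suc (m + k) *_) (sym (symmetry m k)) ⟩
    suc (m + k) * ((m + k) C m) ≡⟨ *-comm (suc (m + k)) _ ⟩
    ((m + k) C m) * suc (m + k)   ∎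
    where open ≡-Reasoning

  recurrence : ∀ k t → let m = suc k + t in
    w m k * suc t * (m + suc k) ≡ w m (suc k) * suc (t + t) * suc k
  recurrence k t = begin
    w m k * suc t * (m + suc k)
      ≡⟨ cong₂ (λ x y → 2 ^ k * x * ((m + k) C m) * suc t * y) middleₖ (+-suc m k) ⟩
    2 ^ k * X * ((m + k) C m) * suc t * suc (m + k)
      ≡⟨ regroup (2 ^ k) X ((m + k) C m) (suc t) (suc (m + k)) ⟩
    2 ^ k * (suc t * X) * (((m + k) C m) * suc (m + k))
      ≡⟨ cong₂ (λ x y → 2 ^ k * x * y) (central t) (sym (upper-shift m k)) ⟩
    2 ^ k * (2 * suc (t + t) * ((t + t) C t)) * (((m + suc k) C m) * suc k)
      ≡⟨ regroup′ (2 ^ k) (suc (t + t)) ((t + t) C t) ((m + suc k) C m) (suc k) ⟩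
    2 ^ suc k * ((t + t) C t) * ((m + suc k) C m) * suc (t + t) * suc k
      ≡⟨ cong (λ x → 2 ^ suc k * x * ((m + suc k) C m) * suc (t + t) * suc k) (sym middleₖ₊₁) ⟩
    w m (suc k) * suc (t + t) * suc k ∎
    where
    open ≡-Reasoning
    m = suc k + t
    X = suc (suc (t + t)) C suc t
    twice : ∀ k t → 2 * suc (k + t) ≡ 2 * k + suc (suc (t + t))
    twice = solve-∀
    twice′ : ∀ k t → 2 * suc (k + t) ≡ 2 * suc k + (t + t)
    twice′ = solve-∀
    middleₖ : (2 * m ∸ 2 * k) C (m ∸ k) ≡ X
    middleₖ = cong₂ _C_ (trans (cong (_∸ 2 * k) (twice k t)) (m+n∸m≡n (2 * k) _))
                        (trans (cong (_∸ k) (sym (+-suc k t))) (m+n∸m≡n k (suc t)))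
    middleₖ₊₁ : (2 * m ∸ 2 * suc k) C (m ∸ suc k) ≡ (t + t) C t
    middleₖ₊₁ = cong₂ _C_ (trans (cong (_∸ 2 * suc k) (twice′ k t)) (m+n∸m≡n (2 * suc k) _)) (m+n∸m≡n (suc k) t)
    regroup : ∀ p x y a b → p * x * y * a * b ≡ p * (a * x) * (y * b)
    regroup = solve-∀
    regroup′ : ∀ p a x y b → p * (2 * a * x) * (y * b) ≡ 2 * p * x * y * a * b
    regroup′ = solve-∀

module Moments where

  open import Data.Nat
  open import Data.Nat.Properties
  open import Data.Nat.Tactic.RingSolver using (solve-∀)
  open import Data.Product using (_,_)
  open import Relation.Binary.PropositionalEquality
  open Sums
  open Weights

  M₀ M₁ M₂ : ℕ → ℕ
  M₀ m = ∑[ k < suc m ] w m k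
  M₁ m = ∑[ k < suc m ] w m k * k
  M₂ m = ∑[ k < suc m ] w m k * (k * k)

  module _ (m : ℕ) where
    -- The two sides of the weight recurrence, as functions of k.
    descending ascending : ℕ → ℕ
    descending k = w m k * (m ∸ k) * (m + suc k)
    ascending k = w m k * suc ((m ∸ k) + (m ∸ k)) * k

  -- The recurrence says descending k = ascending (k+1) for k < m; since
  -- descending m = 0 = ascending 0, both sums over 0 ≤ k ≤ m agree.
  telescope : ∀ m → ∑[ k < suc m ] descending m k ≡ ∑[ k < suc m ] ascending m k
  telescope m = begin
    (∑[ k < m ] descending m k) + descending m m
      ≡⟨ cong (λ x → (∑[ k < m ] descending m k) + w m m * x * (m + suc m)) (n∸n≡0 m) ⟩
    (∑[ k < m ] descending m k) + w m m * 0 * (m + suc m)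
      ≡⟨ cong (λ x → (∑[ k < m ] descending m k) + x * (m + suc m)) (*-zeroʳ (w m m)) ⟩
    (∑[ k < m ] descending m k) + 0
      ≡⟨ +-identityʳ _ ⟩
    ∑[ k < m ] descending m k
      ≡⟨ ∑-cong m shift ⟩
    ∑[ k < m ] ascending m (suc k)
      ≡⟨ sym (cong (_+ (∑[ k < m ] ascending m (suc k))) (*-zeroʳ (w m 0 * suc (m + m)))) ⟩
    ascending m 0 + (∑[ k < m ] ascending m (suc k))
      ≡⟨ sym (∑-head (ascending m) m) ⟩
    ∑[ k < suc m ] ascending m k ∎
    where
    open ≡-Reasoning
    shift : ∀ k → k < m → descending m k ≡ ascending m (suc k)
    shift k k<m with m≤n⇒∃[o]m+o≡n k<m
    ... | t , refl = begin
      w M k * (M ∸ k) * (M + suc k)     ≡⟨ cong (λ x → w M k * x * (M + suc k)) distance ⟩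
      w M k * suc t * (M + suc k)       ≡⟨ recurrence k t ⟩
      w M (suc k) * suc (t + t) * suc k ≡⟨ cong (λ x → w M (suc k) * suc (x + x) * suc k) (sym gap) ⟩
      ascending M (suc k)               ∎
      where
      M = suc k + t
      distance : M ∸ k ≡ suc t
      distance = trans (cong (_∸ k) (sym (+-suc k t))) (m+n∸m≡n k (suc t))
      gap : M ∸ suc k ≡ t
      gap = m+n∸m≡n (suc k) t

  termwise : ∀ m k → k ≤ m →
    descending m k + 2 * suc m * (w m k * k) ≡ ascending m k + ((m + m * m) * w m k + w m k * (k * k))
  termwise m k k≤m with m≤n⇒∃[o]m+o≡n k≤m
  ... | t , refl = subst (λ x → w M k * x * (M + suc k) + 2 * suc M * (w M k * k)
                             ≡ w M k * suc (x + x) * k + ((M + M * M) * w M k + w M k * (k * k)))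
                         (sym (m+n∸m≡n k t)) (polynomial (w M k) k t)
    where
    M = k + t
    polynomial : ∀ W k t → W * t * (k + t + suc k) + 2 * suc (k + t) * (W * k)
                         ≡ W * suc (t + t) * k + ((k + t + (k + t) * (k + t)) * W + W * (k * k))
    polynomial = solve-∀

  moment-identity : ∀ m → 2 * suc m * M₁ m ≡ (m + m * m) * M₀ m + M₂ m
  moment-identity m = +-cancelˡ-≡ (∑[ k < suc m ] descending m k) _ _ (begin
    (∑[ k < suc m ] descending m k) + 2 * suc m * M₁ m
      ≡⟨ cong ((∑[ k < suc m ] descending m k) +_) (sym (∑-*ˡ (2 * suc m) (λ k → w m k * k) (suc m))) ⟩
    (∑[ k < suc m ] descending m k) + (∑[ k < suc m ] 2 * suc m * (w m k * k))
      ≡⟨ sym (∑-+ (descending m) _ (suc m)) ⟩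
    ∑[ k < suc m ] (descending m k + 2 * suc m * (w m k * k))
      ≡⟨ ∑-cong (suc m) (λ k k<1+m → termwise m k (≤-pred k<1+m)) ⟩
    ∑[ k < suc m ] (ascending m k + ((m + m * m) * w m k + w m k * (k * k)))
      ≡⟨ ∑-+ (ascending m) _ (suc m) ⟩
    (∑[ k < suc m ] ascending m k) + (∑[ k < suc m ] ((m + m * m) * w m k + w m k * (k * k)))
      ≡⟨ cong₂ _+_ (sym (telescope m)) (∑-+ (λ k → (m + m * m) * w m k) _ (suc m)) ⟩
    (∑[ k < suc m ] descending m k) + ((∑[ k < suc m ] (m + m * m) * w m k) + M₂ m)
      ≡⟨ cong (λ x → (∑[ k < suc m ] descending m k) + (x + M₂ m)) (∑-*ˡ (m + m * m) (w m) (suc m)) ⟩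
    (∑[ k < suc m ] descending m k) + ((m + m * m) * M₀ m + M₂ m) ∎)
    where open ≡-Reasoning

  M₁≤m*M₀ : ∀ m → M₁ m ≤ m * M₀ m
  M₁≤m*M₀ m = subst (M₁ m ≤_) (∑-*ˡ m (w m) (suc m))
    (∑-mono (suc m) (λ k k<1+m → subst (w m k * k ≤_) (*-comm (w m k) m) (*-monoʳ-≤ (w m k) (≤-pred k<1+m))))

  cauchy-schwarz : ∀ m → M₁ m * M₁ m ≤ M₂ m * M₀ m
  cauchy-schwarz m = chebyshev (w m) (λ k → k) (λ k → k) (λ p → p) (λ p → p) (suc m)

  deficit : ℕ → ℕ
  deficit m = m * M₀ m ∸ M₁ m

  -- T + D = m A, with truncated subtraction harmless since M₁ ≤ m M₀.
  M₁+deficit : ∀ m → M₁ m + deficit m ≡ m * M₀ m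
  M₁+deficit m = m+[n∸m]≡n (M₁≤m*M₀ m)

  variance-algebra : ∀ m A T U D → T + D ≡ m * A → 2 * suc m * T ≡ (m + m * m) * A + U →
    T * T ≤ U * A → D * D + D * A ≤ T * A
  variance-algebra m A T U D T+D≡mA identity cs =
    +-cancelˡ-≤ common _ _ (subst₂ _≤_ (expandˡ A T D) (expandʳ A T D) (begin
      (T + D) * A + (T + D) * (T + D) + T * T
        ≡⟨ cong (λ x → x * A + x * x + T * T) T+D≡mA ⟩
      m * A * A + m * A * (m * A) + T * T
        ≡⟨ cong (_+ T * T) (regroup m A) ⟩
      (m + m * m) * A * A + T * T
        ≤⟨ +-monoʳ-≤ ((m + m * m) * A * A) cs ⟩
      (m + m * m) * A * A + U * A
        ≡⟨ sym (*-distribʳ-+ A ((m + m * m) * A) U) ⟩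
      ((m + m * m) * A + U) * A
        ≡⟨ cong (_* A) (sym identity) ⟩
      2 * suc m * T * A
        ≡⟨ regroup′ m T A ⟩
      2 * T * A + 2 * T * (m * A)
        ≡⟨ cong (λ x → 2 * T * A + 2 * T * x) (sym T+D≡mA) ⟩
      2 * T * A + 2 * T * (T + D) ∎))
    where
    open ≤-Reasoning
    common = T * A + 2 * T * T + 2 * T * D
    regroup : ∀ m A → m * A * A + m * A * (m * A) ≡ (m + m * m) * A * A
    regroup = solve-∀
    regroup′ : ∀ m T A → 2 * suc m * T * A ≡ 2 * T * A + 2 * T * (m * A)
    regroup′ = solve-∀
    expandˡ : ∀ A T D → (T + D) * A + (T + D) * (T + D) + T * T ≡ (T * A + 2 * T * T + 2 * T * D) + (D * D + D * A)
    expandˡ = solve-∀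
    expandʳ : ∀ A T D → 2 * T * A + 2 * T * (T + D) ≡ (T * A + 2 * T * T + 2 * T * D) + T * A
    expandʳ = solve-∀

  deficit-bound : ∀ m → deficit m * deficit m ≤ m * (M₀ m * M₀ m)
  deficit-bound m = begin
    D * D             ≤⟨ m≤m+n (D * D) (D * M₀ m) ⟩
    D * D + D * M₀ m  ≤⟨ variance-algebra m (M₀ m) (M₁ m) (M₂ m) D (M₁+deficit m) (moment-identity m) (cauchy-schwarz m) ⟩
    M₁ m * M₀ m       ≤⟨ *-monoˡ-≤ (M₀ m) (M₁≤m*M₀ m) ⟩
    m * M₀ m * M₀ m   ≡⟨ *-assoc m (M₀ m) (M₀ m) ⟩
    m * (M₀ m * M₀ m) ∎
    where
    open ≤-Reasoning
    D = deficit m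

module BinomialMoments where

  open import Data.Nat
  open import Data.Nat.Properties
  open import Data.Nat.Combinatorics using (_C_)
  open import Data.Nat.Tactic.RingSolver using (solve-∀)
  open import Relation.Binary.PropositionalEquality
  open Binomial
  open Sums
  open Weights
  open Moments

  -- S_j(m) = Σ_k w_m(k) C(k, j) = 4^m d_j(m), and its companion
  -- S′_j(m) = Σ_k w_m(k) C(k, j) k.
  S S′ : ℕ → ℕ → ℕ
  S j m = ∑[ k < suc m ] w m k * (k C j)
  S′ j m = ∑[ k < suc m ] w m k * ((k C j) * k)

  S′-split : ∀ s m → S′ s m ≡ suc s * S (suc s) m + s * S s m
  S′-split s m = sym (begin
    suc s * S (suc s) m + s * S s m
      ≡⟨ sym (cong₂ _+_ (∑-*ˡ (suc s) _ (suc m)) (∑-*ˡ s _ (suc m))) ⟩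
    (∑[ k < suc m ] suc s * (w m k * (k C suc s))) + (∑[ k < suc m ] s * (w m k * (k C s)))
      ≡⟨ sym (∑-+ _ _ (suc m)) ⟩
    ∑[ k < suc m ] (suc s * (w m k * (k C suc s)) + s * (w m k * (k C s)))
      ≡⟨ ∑-cong (suc m) (λ k _ → pointwise k) ⟩
    S′ s m ∎)
    where
    open ≡-Reasoning
    factor : ∀ a b c W x → a * (W * b) + c * (W * x) ≡ W * (a * b + c * x)
    factor = solve-∀
    pointwise : ∀ k → suc s * (w m k * (k C suc s)) + s * (w m k * (k C s)) ≡ w m k * ((k C s) * k)
    pointwise k = begin
      suc s * (w m k * (k C suc s)) + s * (w m k * (k C s))
        ≡⟨ factor (suc s) (k C suc s) s (w m k) (k C s) ⟩
      w m k * (suc s * (k C suc s) + s * (k C s))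
        ≡⟨ cong (w m k *_) (lower-index-step k s) ⟩
      w m k * (k * (k C s))
        ≡⟨ cong (w m k *_) (*-comm k (k C s)) ⟩
      w m k * ((k C s) * k) ∎

  -- Every k in the sum is at most m.
  S′≤m*S : ∀ j m → S′ j m ≤ m * S j m
  S′≤m*S j m = subst (S′ j m ≤_) (∑-*ˡ m _ (suc m))
    (∑-mono (suc m) (λ k k<1+m → subst₂ _≤_ (*-assoc (w m k) (k C j) k) (*-comm (w m k * (k C j)) m)
      (*-monoʳ-≤ (w m k * (k C j)) (≤-pred k<1+m))))

  S*M₁≤S′*M₀ : ∀ j m → S j m * M₁ m ≤ S′ j m * M₀ m
  S*M₁≤S′*M₀ j m = chebyshev (w m) (λ k → k C j) (λ k → k) (upper-monotone j) (λ p → p) (suc m)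

  top-weight-positive : ∀ m → 0 < w m m
  top-weight-positive m = *-mono-< (*-mono-< (m^n>0 2 m) (subst (0 <_) (sym trivial) (s≤s z≤n)))
                                   (positive (m≤m+n m m))
    where
    trivial : (2 * m ∸ 2 * m) C (m ∸ m) ≡ 1
    trivial = cong₂ _C_ (n∸n≡0 (2 * m)) (n∸n≡0 m)

  -- Both S_j(m) (for j ≤ m) and M₀(m) contain the positive top weight.
  S-positive : ∀ {j m} → j ≤ m → 0 < S j m
  S-positive {j} {m} j≤m = ≤-trans (*-mono-< (top-weight-positive m) (positive j≤m)) (term≤∑ _ m)

  M₀-positive : ∀ m → 0 < M₀ m
  M₀-positive m = ≤-trans (top-weight-positive m) (term≤∑ (w m) m)

module Estimates where

  open import Data.Nat
  open import Data.Nat.Properties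
  open import Data.Nat.Tactic.RingSolver using (solve-∀)
  open import Data.Product using (_,_; _×_)
  open import Data.Empty using (⊥-elim)
  open import Relation.Nullary using (yes; no)
  open import Relation.Binary.PropositionalEquality
  open Moments
  open BinomialMoments

  square-comparison : ∀ n x y m t → 0 < y → x * x ≤ m * (y * y) → n * n * m < t * t → n * x < t * y
  square-comparison n x y m t y>0 x²≤my² n²m<t² with n * x <? t * y
  ... | yes nx<ty = nx<ty
  ... | no nx≮ty = ⊥-elim (<⇒≱ n²m<t² (*-cancelʳ-≤ (t * t) (n * n * m) (y * y) {{>-nonZero (*-mono-< y>0 y>0)}} (begin
    t * t * (y * y)     ≡⟨ square-product t y ⟩
    (t * y) * (t * y)   ≤⟨ *-mono-≤ (≮⇒≥ nx≮ty) (≮⇒≥ nx≮ty) ⟩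
    (n * x) * (n * x)   ≡⟨ sym (square-product n x) ⟩
    n * n * (x * x)     ≤⟨ *-monoʳ-≤ (n * n) x²≤my² ⟩
    n * n * (m * (y * y)) ≡⟨ sym (*-assoc (n * n) m (y * y)) ⟩
    n * n * m * (y * y) ∎)))
    where
    open ≤-Reasoning
    square-product : ∀ a b → a * a * (b * b) ≡ (a * b) * (a * b)
    square-product = solve-∀

  threshold : ∀ K i t → K + i + 1 ≤ t → K * (i + t) < t * t
  threshold K i t K+i+1≤t with m≤n⇒∃[o]m+o≡n K+i+1≤t
  ... | e , refl = subst (K * (i + t′) <_) (sym (expand K i e)) (s≤s (m≤m+n _ _))
    where
    t′ = K + i + 1 + e
    expand : ∀ K i e → (K + i + 1 + e) * (K + i + 1 + e)
                     ≡ 1 + (K * (i + (K + i + 1 + e)) + (K * (1 + e) + (i + e) + (i + e) * (1 + (i + e))))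
    expand = solve-∀

  tilted-mass-bound : ∀ N A T D q B a u → q * T ≤ (B + a * q) * A → T + D ≡ (a + u) * A →
    suc N * D < u * A → 0 < q → 0 < A → N * q * u < suc N * B
  tilted-mass-bound N A T D q B a u tilt mean small q>0 A>0 =
    *-cancelʳ-< A _ _ (+-cancelʳ-< (q * u * A) _ _ (subst₂ _<_ (regroupˡ N q u A) (regroupʳ N B A q u) (begin-strict
      suc N * (q * u * A)      ≤⟨ *-monoʳ-≤ (suc N) shifted ⟩
      suc N * (B * A + q * D)  ≡⟨ distribute (suc N) B A q D ⟩
      suc N * (B * A) + q * (suc N * D) <⟨ +-monoʳ-< (suc N * (B * A)) (*-monoʳ-< q small) ⟩
      suc N * (B * A) + q * (u * A) ≡⟨ cong (suc N * (B * A) +_) (sym (*-assoc q u A)) ⟩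
      suc N * (B * A) + q * u * A ∎)))
    where
    open ≤-Reasoning
    instance _ = >-nonZero q>0
    -- q u A ≤ B A + q D: the tilt inequality with T = (a + u) A - D substituted.
    shifted : q * u * A ≤ B * A + q * D
    shifted = +-cancelˡ-≤ (a * q * A) _ _ (subst₂ _≤_ expandˡ (expandʳ B a q A (q * D)) (+-monoˡ-≤ (q * D) tilt))
      where
      expandʳ : ∀ B a q A x → (B + a * q) * A + x ≡ a * q * A + (B * A + x)
      expandʳ = solve-∀
      spread : ∀ q a u A → q * ((a + u) * A) ≡ a * q * A + q * u * A
      spread = solve-∀
      expandˡ : q * T + q * D ≡ a * q * A + q * u * A
      expandˡ = trans (sym (*-distribˡ-+ q T D)) (trans (cong (q *_) mean) (spread q a u A))
    distribute : ∀ n B A q D → n * (B * A + q * D) ≡ n * (B * A) + q * (n * D)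
    distribute = solve-∀
    regroupˡ : ∀ N q u A → suc N * (q * u * A) ≡ N * q * u * A + q * u * A
    regroupˡ = solve-∀
    regroupʳ : ∀ N B A q u → suc N * (B * A) + q * u * A ≡ suc N * B * A + q * u * A
    regroupʳ = solve-∀

  cancel-common : ∀ x s u P → x + s * P ≤ (s + u) * P → x ≤ u * P
  cancel-common x s u P h = +-cancelʳ-≤ (s * P) x (u * P)
    (subst (x + s * P ≤_) (trans (*-distribʳ-+ P s u) (+-comm (s * P) (u * P))) h)

  multiply-bounds : ∀ {x y z v} → x < y → z ≤ v → 0 < v → x * z < y * v
  multiply-bounds {x} {y} {z} {v} x<y z≤v v>0 = ≤-<-trans (*-monoʳ-≤ x z≤v) (*-monoˡ-< v x<y)
    where instance _ = >-nonZero v>0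

  -- For i = s+1 and m = i + t, c_i(m)/u_i(m) = numerator/denominator with
  --   numerator   = S_i² · i · t,   denominator = S_{i-1} S_{i+1} · (i+1)(t+1).
  module _ (s t : ℕ) where
    numerator denominator : ℕ
    numerator = S (suc s) (suc s + t) * S (suc s) (suc s + t) * suc s * t
    denominator = S s (suc s + t) * S (suc (suc s)) (suc s + t) * suc (suc s) * suc t

  -- Upper and lower bounds each combine one exact
  -- inequality (every k ≤ m) with one concentration inequality (the mean of
  -- k is within (N+1)⁻¹ t of m).
  pinched : ∀ N s t → suc N * suc N + suc s + 1 ≤ t →
    N * numerator s t < suc N * denominator s t × N * denominator s t < suc N * numerator s t
  pinched N s t large = upper , lower
    where
    i = suc s
    m = i + t
    P = S s m
    Q = S i m
    R = S (suc i) m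
    A = M₀ m
    T = M₁ m
    D = deficit m
    t≥1 : 1 ≤ t
    t≥1 = ≤-trans (m≤n+m 1 (suc N * suc N + i)) large
    A>0 : 0 < A
    A>0 = M₀-positive m
    P>0 : 0 < P
    P>0 = S-positive (≤-trans (n≤1+n s) (m≤m+n i t))
    Q>0 : 0 < Q
    Q>0 = S-positive (m≤m+n i t)
    m≡s+[1+t] : m ≡ s + suc t
    m≡s+[1+t] = sym (+-suc s t)
    small : suc N * D < t * A
    small = square-comparison (suc N) D A m t A>0 (deficit-bound m) (threshold (suc N * suc N) i t large)
    iQ≤[1+t]P : i * Q ≤ suc t * P
    iQ≤[1+t]P = cancel-common (i * Q) s (suc t) P
      (subst₂ (λ x y → x ≤ y * P) (S′-split s m) m≡s+[1+t] (S′≤m*S s m))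
    [1+i]R≤tQ : suc i * R ≤ t * Q
    [1+i]R≤tQ = cancel-common (suc i * R) i t Q (subst (_≤ m * Q) (S′-split i m) (S′≤m*S i m))
    NQt<[1+N][1+i]R : N * Q * t < suc N * (suc i * R)
    NQt<[1+N][1+i]R = tilted-mass-bound N A T D Q (suc i * R) i t
      (subst (λ x → Q * T ≤ x * A) (S′-split i m) (S*M₁≤S′*M₀ i m)) (M₁+deficit m) small Q>0 A>0
    NP[1+t]<[1+N]iQ : N * P * suc t < suc N * (i * Q)
    NP[1+t]<[1+N]iQ = tilted-mass-bound N A T D P (i * Q) s (suc t)
      (subst (λ x → P * T ≤ x * A) (S′-split s m) (S*M₁≤S′*M₀ s m))
      (trans (M₁+deficit m) (cong (_* A) m≡s+[1+t])) (<-≤-trans small (*-monoˡ-≤ A (n≤1+n t))) P>0 A>0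
    upper : N * numerator s t < suc N * denominator s t
    upper = subst₂ _<_ (regroupˡ N Q i t) (regroupʳ N i R t P)
      (multiply-bounds NQt<[1+N][1+i]R iQ≤[1+t]P (*-mono-< {0} {suc t} (s≤s z≤n) P>0))
      where
      regroupˡ : ∀ N Q i t → N * Q * t * (i * Q) ≡ N * (Q * Q * i * t)
      regroupˡ = solve-∀
      regroupʳ : ∀ N i R t P → suc N * (suc i * R) * (suc t * P) ≡ suc N * (P * R * suc i * suc t)
      regroupʳ = solve-∀
    lower : N * denominator s t < suc N * numerator s t
    lower = subst₂ _<_ (regroupˡ N P t i R) (regroupʳ N i Q t)
      (multiply-bounds NP[1+t]<[1+N]iQ [1+i]R≤tQ (*-mono-< t≥1 Q>0))
      where
      regroupˡ : ∀ N P t i R → N * P * suc t * (suc i * R) ≡ N * (P * R * suc i * suc t)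
      regroupˡ = solve-∀
      regroupʳ : ∀ N i Q t → suc N * (i * Q) * (t * Q) ≡ suc N * (Q * Q * i * t)
      regroupʳ = solve-∀

module Rationals where

  open import Data.Nat as ℕ using (suc)
  import Data.Nat.Properties as ℕ
  open import Data.Integer as ℤ using (+_)
  import Data.Integer.Properties as ℤ
  import Data.Nat.Coprimality as Coprime
  open import Data.Rational
  open import Data.Rational.Properties
  open import Data.Rational.Solver using (module +-*-Solver)
  open import Data.Sum using (inj₁; inj₂)
  open import Data.Empty using (⊥-elim)
  open import Relation.Nullary using (yes; no)
  open import Relation.Binary.PropositionalEquality
  import Data.Rational.Unnormalised as ℚᵘ
  import Data.Rational.Unnormalised.Properties as ℚᵘ
  open import Defs using (ℕ→ℚ; _/ℚ_)
  open +-*-Solver using (solve; _:+_; _:*_; :-_; _:=_; con)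

  ℕ→ℚ≡mkℚ : ∀ n → ℕ→ℚ n ≡ mkℚ (+ n) 0 (Coprime.sym (Coprime.1-coprimeTo n))
  ℕ→ℚ≡mkℚ n = normalize-coprime (Coprime.sym (Coprime.1-coprimeTo n))

  ℕ→ℚ-+ : ∀ x y → ℕ→ℚ (x ℕ.+ y) ≡ ℕ→ℚ x + ℕ→ℚ y
  ℕ→ℚ-+ x y = sym (trans (cong₂ _+_ (ℕ→ℚ≡mkℚ x) (ℕ→ℚ≡mkℚ y))
    (/-cong (trans (cong₂ ℤ._+_ (ℤ.*-identityʳ (+ x)) (ℤ.*-identityʳ (+ y))) (sym (ℤ.pos-+ x y))) refl))

  ℕ→ℚ-* : ∀ x y → ℕ→ℚ (x ℕ.* y) ≡ ℕ→ℚ x * ℕ→ℚ y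
  ℕ→ℚ-* x y = sym (trans (cong₂ _*_ (ℕ→ℚ≡mkℚ x) (ℕ→ℚ≡mkℚ y)) (/-cong (sym (ℤ.pos-* x y)) refl))

  ℕ→ℚ-mono-< : ∀ {x y} → x ℕ.< y → ℕ→ℚ x < ℕ→ℚ y
  ℕ→ℚ-mono-< {x} {y} x<y = subst₂ _<_ (sym (ℕ→ℚ≡mkℚ x)) (sym (ℕ→ℚ≡mkℚ y))
    (*<* (subst₂ ℤ._<_ (sym (ℤ.*-identityʳ (+ x))) (sym (ℤ.*-identityʳ (+ y))) (ℤ.+<+ x<y)))

  ℕ→ℚ-mono-≤ : ∀ {x y} → x ℕ.≤ y → ℕ→ℚ x ≤ ℕ→ℚ y
  ℕ→ℚ-mono-≤ {x} {y} x≤y = subst₂ _≤_ (sym (ℕ→ℚ≡mkℚ x)) (sym (ℕ→ℚ≡mkℚ y))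
    (*≤* (subst₂ ℤ._≤_ (sym (ℤ.*-identityʳ (+ x))) (sym (ℤ.*-identityʳ (+ y))) (ℤ.+≤+ x≤y)))

  ℕ→ℚ-nonNeg : ∀ n → NonNegative (ℕ→ℚ n)
  ℕ→ℚ-nonNeg n = subst NonNegative (sym (ℕ→ℚ≡mkℚ n)) _

  ℕ→ℚ-nonZero : ∀ n → 0 ℕ.< n → ℕ→ℚ n ≢ 0ℚ
  ℕ→ℚ-nonZero n n>0 n≡0 = <-irrefl (sym n≡0) (ℕ→ℚ-mono-< n>0)

  /ℚ-cancel : ∀ p q → q ≢ 0ℚ → (p /ℚ q) * q ≡ p
  /ℚ-cancel p q q≢0 with q ≟ 0ℚ
  ... | yes q≡0 = ⊥-elim (q≢0 q≡0)
  ... | no q≢0′ = trans (*-assoc p (1/ q) q) (trans (cong (p *_) (*-inverseˡ q)) (*-identityʳ p))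
    where instance _ = ≢-nonZero q≢0′

  factor-nonZero : ∀ x y z → x * y ≡ z → z ≢ 0ℚ → x ≢ 0ℚ
  factor-nonZero x y z xy≡z z≢0 x≡0 = z≢0 (trans (sym xy≡z) (trans (cong (_* y) x≡0) (*-zeroˡ y)))

  archimedean : ∀ ε → ε > 0ℚ → 1ℚ ≤ ℕ→ℚ (↧ₙ ε) * ε
  archimedean (mkℚ (+ 0) d _) (*<* (ℤ.+<+ ()))
  archimedean (mkℚ ℤ.-[1+ p ] d _) (*<* ())
  archimedean ε@(mkℚ ℤ.+[1+ p ] d _) _ rewrite ℕ→ℚ≡mkℚ (suc d) =
    toℚᵘ-cancel-≤ (ℚᵘ.≤-respʳ-≃ (ℚᵘ.≃-sym (toℚᵘ-homo-* (mkℚ (+ suc d) 0 (Coprime.sym (Coprime.1-coprimeTo (suc d)))) ε))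
      (ℚᵘ.*≤* (subst₂ ℤ._≤_ lhs rhs (ℤ.+≤+ (ℕ.m≤m*n (suc d) (suc p))))))
    where
    lhs : + suc d ≡ + 1 ℤ.* + suc (d ℕ.+ 0)
    lhs = trans (cong (λ z → + suc z) (sym (ℕ.+-identityʳ d))) (sym (ℤ.*-identityˡ _))
    rhs : + (suc d ℕ.* suc p) ≡ (+ suc d ℤ.* + suc p) ℤ.* + 1
    rhs = trans (ℤ.pos-* (suc d) (suc p)) (sym (ℤ.*-identityʳ _))

  unit-gap : ∀ N → ℕ→ℚ (suc N) - ℕ→ℚ N ≡ 1ℚ
  unit-gap N = trans (cong (_- ℕ→ℚ N) (ℕ→ℚ-+ 1 N)) (cancel (ℕ→ℚ N))
    where
    cancel : ∀ n → (1ℚ + n) - n ≡ 1ℚ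
    cancel = solve 1 (λ n → (con 1ℚ :+ n) :+ :- n := con 1ℚ) refl

  -- N(r - 1) < (N+1) - N = 1 ≤ Nε bounds r - 1 from above.
  excess-bound : ∀ N r ε → ℕ→ℚ N * r < ℕ→ℚ (suc N) → 1ℚ ≤ ℕ→ℚ N * ε → r - 1ℚ < ε
  excess-bound N r ε Nr<N+1 1≤Nε = *-cancelˡ-<-nonNeg n {{ℕ→ℚ-nonNeg N}}
    (<-≤-trans (subst₂ _<_ (sym (expand n r)) (unit-gap N) (+-monoˡ-< (- n) Nr<N+1)) 1≤Nε)
    where
    n = ℕ→ℚ N
    expand : ∀ n r → n * (r - 1ℚ) ≡ n * r - n
    expand = solve 2 (λ n r → n :* (r :+ :- con 1ℚ) := n :* r :+ :- n) refl

  -- (N+1)(1 - r) < (N+1) - N = 1 ≤ Nε ≤ (N+1)ε bounds 1 - r from above.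
  shortfall-bound : ∀ N r ε → ℕ→ℚ N < ℕ→ℚ (suc N) * r → ε > 0ℚ → 1ℚ ≤ ℕ→ℚ N * ε → - (r - 1ℚ) < ε
  shortfall-bound N r ε N<[N+1]r ε>0 1≤Nε = *-cancelˡ-<-nonNeg n′ {{ℕ→ℚ-nonNeg (suc N)}}
    (<-≤-trans (subst₂ _<_ (sym (expand n′ r)) (unit-gap N) (+-monoʳ-< n′ (neg-antimono-< N<[N+1]r)))
      (≤-trans 1≤Nε (*-monoʳ-≤-nonNeg ε {{nonNegative (<⇒≤ ε>0)}} (ℕ→ℚ-mono-≤ (ℕ.n≤1+n N)))))
    where
    n′ = ℕ→ℚ (suc N)
    expand : ∀ n r → n * (- (r - 1ℚ)) ≡ n - n * r
    expand = solve 2 (λ n r → n :* (:- (r :+ :- con 1ℚ)) := n :+ :- (n :* r)) refl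

  pinched⇒close : ∀ N r ε → ℕ→ℚ N * r < ℕ→ℚ (suc N) → ℕ→ℚ N < ℕ→ℚ (suc N) * r →
    ε > 0ℚ → 1ℚ ≤ ℕ→ℚ N * ε → ∣ r - 1ℚ ∣ < ε
  pinched⇒close N r ε Nr<N+1 N<[N+1]r ε>0 1≤Nε with ∣p∣≡p∨∣p∣≡-p (r - 1ℚ)
  ... | inj₁ ∣r-1∣≡r-1 = subst (_< ε) (sym ∣r-1∣≡r-1) (excess-bound N r ε Nr<N+1 1≤Nε)
  ... | inj₂ ∣r-1∣≡1-r = subst (_< ε) (sym ∣r-1∣≡1-r) (shortfall-bound N r ε N<[N+1]r ε>0 1≤Nε)

  ratio-close : ∀ N X Y r ε → r * ℕ→ℚ Y ≡ ℕ→ℚ X →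
    N ℕ.* X ℕ.< suc N ℕ.* Y → N ℕ.* Y ℕ.< suc N ℕ.* X → ε > 0ℚ → 1ℚ ≤ ℕ→ℚ N * ε → ∣ r - 1ℚ ∣ < ε
  ratio-close N X Y r ε rY≡X NX<[N+1]Y NY<[N+1]X =
    pinched⇒close N r ε (cancelY (subst₂ _<_ (scaled N) (ℕ→ℚ-* (suc N) Y) (ℕ→ℚ-mono-< NX<[N+1]Y)))
                        (cancelY (subst₂ _<_ (ℕ→ℚ-* N Y) (scaled (suc N)) (ℕ→ℚ-mono-< NY<[N+1]X)))
    where
    cancelY : ∀ {p q} → p * ℕ→ℚ Y < q * ℕ→ℚ Y → p < q
    cancelY = *-cancelʳ-<-nonNeg (ℕ→ℚ Y) {{ℕ→ℚ-nonNeg Y}}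
    scaled : ∀ M → ℕ→ℚ (M ℕ.* X) ≡ ℕ→ℚ M * r * ℕ→ℚ Y
    scaled M = trans (ℕ→ℚ-* M X) (trans (cong (ℕ→ℚ M *_) (sym rY≡X)) (sym (*-assoc (ℕ→ℚ M) r (ℕ→ℚ Y))))

module Ratio where

  open import Data.Nat as ℕ using (ℕ; suc; _^_)
  import Data.Nat.Properties as ℕ
  open import Data.Nat.Combinatorics using (_C_)
  open import Data.Rational
  open import Data.Rational.Properties
  open import Data.Rational.Solver using (module +-*-Solver)
  open import Relation.Binary.PropositionalEquality
  open import Defs
  open Sums using (sum-upTo)
  open Weights using (w)
  open BinomialMoments using (S; S-positive)
  open Estimates using (numerator; denominator; pinched)
  open import Data.Product using (proj₁; proj₂)
  open Rationals
  open +-*-Solver using (solve; _:+_; _:*_; _:=_; con)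

  one-plus-inverse : ∀ x → x ≢ 0ℚ → (1ℚ + (1ℚ /ℚ x)) * x ≡ 1ℚ + x
  one-plus-inverse x x≢0 = trans (distribute (1ℚ /ℚ x) x) (trans (cong (x +_) (/ℚ-cancel 1ℚ x x≢0)) (+-comm x 1ℚ))
    where
    distribute : ∀ y x → (1ℚ + y) * x ≡ x + y * x
    distribute = solve 2 (λ y x → (con 1ℚ :+ y) :* x := x :+ y :* x) refl

  interchange : ∀ a b x y → (a * b) * (x * y) ≡ (a * x) * (b * y)
  interchange = solve 4 (λ a b x y → (a :* b) :* (x :* y) := (a :* x) :* (b :* y)) refl

  module _ (s t : ℕ) (t≥1 : 1 ℕ.≤ t) where
    private
      i = suc s
      m = i ℕ.+ t
      F = ℕ→ℚ (2 ^ (2 ℕ.* m))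
      P = S s m
      Q = S i m
      R = S (suc i) m

      d-scaled : ∀ j → d j m * F ≡ ℕ→ℚ (S j m)
      d-scaled j = trans (/ℚ-cancel (ℕ→ℚ (bmSum j m)) F (ℕ→ℚ-nonZero _ (ℕ.m^n>0 2 (2 ℕ.* m))))
                         (cong ℕ→ℚ (sum-upTo (λ k → w m k ℕ.* (k C j)) (suc m)))

      u-scaled : u i m * ℕ→ℚ (i ℕ.* t) ≡ ℕ→ℚ (suc i ℕ.* suc t)
      u-scaled = begin
        (1ℚ + (1ℚ /ℚ ℕ→ℚ i)) * (1ℚ + (1ℚ /ℚ ℕ→ℚ (m ℕ.∸ i))) * ℕ→ℚ (i ℕ.* t)
          ≡⟨ cong₂ (λ x y → (1ℚ + (1ℚ /ℚ ℕ→ℚ i)) * (1ℚ + (1ℚ /ℚ ℕ→ℚ x)) * y) (ℕ.m+n∸m≡n i t) (ℕ→ℚ-* i t) ⟩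
        (1ℚ + (1ℚ /ℚ ℕ→ℚ i)) * (1ℚ + (1ℚ /ℚ ℕ→ℚ t)) * (ℕ→ℚ i * ℕ→ℚ t)
          ≡⟨ interchange (1ℚ + (1ℚ /ℚ ℕ→ℚ i)) (1ℚ + (1ℚ /ℚ ℕ→ℚ t)) (ℕ→ℚ i) (ℕ→ℚ t) ⟩
        ((1ℚ + (1ℚ /ℚ ℕ→ℚ i)) * ℕ→ℚ i) * ((1ℚ + (1ℚ /ℚ ℕ→ℚ t)) * ℕ→ℚ t)
          ≡⟨ cong₂ _*_ (one-plus-inverse (ℕ→ℚ i) (ℕ→ℚ-nonZero i (ℕ.s≤s ℕ.z≤n))) (one-plus-inverse (ℕ→ℚ t) (ℕ→ℚ-nonZero t t≥1)) ⟩
        (1ℚ + ℕ→ℚ i) * (1ℚ + ℕ→ℚ t)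
          ≡⟨ sym (trans (ℕ→ℚ-* (suc i) (suc t)) (cong₂ _*_ (ℕ→ℚ-+ 1 i) (ℕ→ℚ-+ 1 t))) ⟩
        ℕ→ℚ (suc i ℕ.* suc t) ∎
        where open ≡-Reasoning

      u≢0 : u i m ≢ 0ℚ
      u≢0 = factor-nonZero _ _ _ u-scaled (ℕ→ℚ-nonZero _ (ℕ.*-mono-< {0} {suc i} {0} {suc t} (ℕ.s≤s ℕ.z≤n) (ℕ.s≤s ℕ.z≤n)))

      c-scaled : c i m * (d s m * d (suc i) m) ≡ d i m * d i m
      c-scaled = /ℚ-cancel (d i m * d i m) (d s m * d (suc i) m) (factor-nonZero _ _ _ scaled
        (ℕ→ℚ-nonZero _ (ℕ.*-mono-< (S-positive (ℕ.≤-trans (ℕ.n≤1+n s) (ℕ.m≤m+n i t))) (S-positive (ℕ.s≤s (ℕ.≤-trans (ℕ.≤-reflexive (ℕ.+-comm 1 s)) (ℕ.+-monoʳ-≤ s t≥1)))))))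
        where
        scaled : (d s m * d (suc i) m) * (F * F) ≡ ℕ→ℚ (P ℕ.* R)
        scaled = trans (interchange (d s m) (d (suc i) m) F F)
                       (trans (cong₂ _*_ (d-scaled s) (d-scaled (suc i))) (sym (ℕ→ℚ-* P R)))

    ratio-identity : (c i m /ℚ u i m) * ℕ→ℚ (denominator s t) ≡ ℕ→ℚ (numerator s t)
    ratio-identity = begin
      r * ℕ→ℚ (P ℕ.* R ℕ.* suc i ℕ.* suc t)
        ≡⟨ cong (λ x → r * ℕ→ℚ x) (ℕ.*-assoc (P ℕ.* R) (suc i) (suc t)) ⟩
      r * ℕ→ℚ (P ℕ.* R ℕ.* (suc i ℕ.* suc t))
        ≡⟨ cong (r *_) (trans (ℕ→ℚ-* (P ℕ.* R) _) (cong (_* ℕ→ℚ (suc i ℕ.* suc t)) (ℕ→ℚ-* P R))) ⟩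
      r * (ℕ→ℚ P * ℕ→ℚ R * ℕ→ℚ (suc i ℕ.* suc t))
        ≡⟨ cong₂ (λ x y → r * (x * y)) (cong₂ _*_ (sym (d-scaled s)) (sym (d-scaled (suc i)))) (sym u-scaled) ⟩
      r * ((d s m * F) * (d (suc i) m * F) * (u i m * it))
        ≡⟨ regroup r (d s m) (d (suc i) m) F (u i m) it ⟩
      (r * u i m) * (d s m * d (suc i) m) * (F * F * it)
        ≡⟨ cong (λ x → x * (d s m * d (suc i) m) * (F * F * it)) (/ℚ-cancel (c i m) (u i m) u≢0) ⟩
      c i m * (d s m * d (suc i) m) * (F * F * it)
        ≡⟨ cong (_* (F * F * it)) c-scaled ⟩
      d i m * d i m * (F * F * it)
        ≡⟨ regroup′ (d i m) F it ⟩
      (d i m * F) * (d i m * F) * it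
        ≡⟨ cong (λ x → x * x * it) (d-scaled i) ⟩
      ℕ→ℚ Q * ℕ→ℚ Q * it
        ≡⟨ sym (trans (ℕ→ℚ-* (Q ℕ.* Q) (i ℕ.* t)) (cong (_* it) (ℕ→ℚ-* Q Q))) ⟩
      ℕ→ℚ (Q ℕ.* Q ℕ.* (i ℕ.* t))
        ≡⟨ cong ℕ→ℚ (sym (ℕ.*-assoc (Q ℕ.* Q) i t)) ⟩
      ℕ→ℚ (Q ℕ.* Q ℕ.* i ℕ.* t) ∎
      where
      open ≡-Reasoning
      r = c i m /ℚ u i m
      it = ℕ→ℚ (i ℕ.* t)
      regroup : ∀ r a b F v x → r * ((a * F) * (b * F) * (v * x)) ≡ (r * v) * (a * b) * (F * F * x)
      regroup = solve 6 (λ r a b F v x → r :* ((a :* F) :* (b :* F) :* (v :* x)) := (r :* v) :* (a :* b) :* (F :* F :* x)) refl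
      regroup′ : ∀ a F x → a * a * (F * F * x) ≡ (a * F) * (a * F) * x
      regroup′ = solve 3 (λ a F x → a :* a :* (F :* F :* x) := (a :* F) :* (a :* F) :* x) refl

  close-beyond : ∀ N s t ε → suc N ℕ.* suc N ℕ.+ suc s ℕ.+ 1 ℕ.≤ t → ε > 0ℚ → 1ℚ ≤ ℕ→ℚ N * ε →
    ∣ (c (suc s) (suc s ℕ.+ t) /ℚ u (suc s) (suc s ℕ.+ t)) - 1ℚ ∣ < ε
  close-beyond N s t ε large =
    ratio-close N (numerator s t) (denominator s t) (c (suc s) (suc s ℕ.+ t) /ℚ u (suc s) (suc s ℕ.+ t)) ε
      (ratio-identity s t t≥1) (proj₁ (pinched N s t large)) (proj₂ (pinched N s t large))
    where
    t≥1 : 1 ℕ.≤ t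
    t≥1 = ℕ.≤-trans (ℕ.m≤n+m 1 (suc N ℕ.* suc N ℕ.+ suc s)) large

open import Defs
open import Data.Nat using (ℕ; _≥_)
open import Data.Product using (∃-syntax)
open import Data.Rational using (ℚ; 0ℚ; 1ℚ; _-_; ∣_∣; _<_; _>_)

open import Data.Nat using (zero; suc; _+_; _*_; _∸_; _≤_)
open import Data.Nat.Properties using (≤-trans; m≤m+n; m+[n∸m]≡n; m+n∸m≡n; ∸-monoˡ-≤)
open import Data.Rational using (↧ₙ_)
open import Data.Product using (_,_)
open import Relation.Binary.PropositionalEquality using (subst)
open Rationals using (archimedean)
open Ratio using (close-beyond)

corollary4p2 : (i : ℕ) → i ≥ 1 → (ε : ℚ) → ε > 0ℚ →
    ∃[ M ] ((m : ℕ) → m ≥ M → ∣ (c i m /ℚ u i m) - 1ℚ ∣ < ε)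
corollary4p2 zero ()
corollary4p2 (suc s) _ ε ε>0 = suc s + T , beyond
  where
  -- N = denominator of ε satisfies 1 ≤ N ε; T is the matching threshold for t = m - i.
  N = ↧ₙ ε
  T = suc N * suc N + suc s + 1
  beyond : ∀ m → m ≥ suc s + T → ∣ (c (suc s) m /ℚ u (suc s) m) - 1ℚ ∣ < ε
  beyond m m≥M = subst (λ m → ∣ (c (suc s) m /ℚ u (suc s) m) - 1ℚ ∣ < ε) (m+[n∸m]≡n i≤m)
    (close-beyond N s (m ∸ suc s) ε t≥T ε>0 (archimedean ε ε>0))
    where
    i≤m : suc s ≤ m
    i≤m = ≤-trans (m≤m+n (suc s) T) m≥M
    t≥T : T ≤ m ∸ suc s
    t≥T = subst (_≤ m ∸ suc s) (m+n∸m≡n (suc s) T) (∸-monoˡ-≤ (suc s) m≥M)
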